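{- Let $m$ be odd and let $G$ be either an abelian group of order $2m$ or the dihedral group of order $2m$. Let $\psi:G\times G\to\{\pm1\}$ be a normalized cocycle, and if $G$ is dihedral assume that $\psi$ is not a coboundary. Then $M_\psi=[\psi(g,h)]_{g,h\in G}$ (rows and columns indexed by the elements of $G$ in the same order) is normal, i.e. $M_\psi M_\psi^\top=M_\psi^\top M_\psi$.
   Context: A normalized cocycle satisfies $\psi(1,1)=1$ and $\psi(g,h)\psi(gh,k)=\psi(g,hk)\psi(h,k)$; a coboundary is one of the form $\partial\varphi(g,h)=\varphi(g)^{ -1}\varphi(h)^{ -1}\varphi(gh)$ with $\varphi:G\to\{\pm1\}$, $\varphi(1)=1$. -}

module Defs where

open import Data.Nat as ℕ using (ℕ; suc; NonZero)
open import Data.Nat.DivMod using (_mod_)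
open import Data.Fin using (Fin; toℕ; zero)
open import Data.Bool using (Bool; true; false; not)
open import Data.Product using (_×_; _,_; ∃)
open import Data.List using (List; map; foldr; allFin; concatMap; [_]; _∷_; [])
open import Data.Sign using (Sign) renaming (_*_ to _⊛_; + to s+)
open import Data.Integer as ℤ using (ℤ; _◃_)
open import Relation.Binary.PropositionalEquality using (_≡_)

-- ±1 is modelled by Data.Sign (+ ↦ 1, - ↦ -1), a group under _⊛_.
signToℤ : Sign → ℤ
signToℤ s = s ◃ 1

sumℤ : List ℤ → ℤ
sumℤ = foldr ℤ._+_ (ℤ.+ 0)

IsNormalizedCocycle : {A : Set} → (A → A → A) → A → (A → A → Sign) → Set
IsNormalizedCocycle {A} _∙_ e ψ =
  (ψ e e ≡ s+) ×
  (∀ g h k → ψ g h ⊛ ψ (g ∙ h) k ≡ ψ g (h ∙ k) ⊛ ψ h k)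

-- Coboundary: ψ(g,h) = φ(g)⁻¹ φ(h)⁻¹ φ(gh), φ(1) = 1.  In {±1}, x⁻¹ = x.
IsCoboundary : {A : Set} → (A → A → A) → A → (A → A → Sign) → Set
IsCoboundary {A} _∙_ e ψ =
  ∃ λ (φ : A → Sign) → (φ e ≡ s+) × (∀ g h → ψ g h ≡ φ g ⊛ φ h ⊛ φ (g ∙ h))

-- The matrix M = [ψ(g,h)] with rows/columns indexed by the list `els`
-- (enumerating every element exactly once) is normal: M Mᵀ = Mᵀ M entrywise,
-- i.e. Σₖ ψ(g,k)ψ(h,k) = Σₖ ψ(k,g)ψ(k,h) for all g, h.
IsNormalMatrix : {A : Set} → List A → (A → A → Sign) → Set
IsNormalMatrix {A} els ψ = ∀ (g h : A) →
  sumℤ (map (λ k → signToℤ (ψ g k) ℤ.* signToℤ (ψ h k)) els)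
    ≡ sumℤ (map (λ k → signToℤ (ψ k g) ℤ.* signToℤ (ψ k h)) els)

-- Dihedral group D_m of order 2m (m ≥ 1): the pair (i , b) stands for rⁱ sᵇ,
-- with rᵐ = 1, s² = 1, s r s = r⁻¹.  Hence
--   rⁱ · r^k s^c = r^{i+k} s^c,   rⁱ s · r^k s^c = r^{i-k} s^{1+c}.
Dihedral : ℕ → Set
Dihedral m = Fin m × Bool

module _ (m : ℕ) .{{_ : NonZero m}} where

  dihMul : Dihedral m → Dihedral m → Dihedral m
  dihMul (i , false) (k , c) = ((toℕ i ℕ.+ toℕ k) mod m , c)
  dihMul (i , true)  (k , c) = ((toℕ i ℕ.+ (m ℕ.∸ toℕ k)) mod m , not c)

  dihOne : Dihedral m
  dihOne = (0 mod m , false)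

  dihElems : List (Dihedral m)
  dihElems = concatMap (λ i → (i , false) ∷ (i , true) ∷ []) (allFin m)

-- The commutator β(x, y) = ψ(x, y) ψ(y, x) is multiplicative in x (three cocycle identities)
-- and β(x, x) = 1. If β(g, h) = -1 then β(-, g), β(-, h) and their product are nontrivial characters, and
-- counting Σₖ (1 + β(k, g)) (1 + β(k, h)) shows 4 ∣ |G|, which fails for |G| = 2m, m odd. So ψ is symmetric.
--
-- In any group, if h = x g = g y then the cocycle identity gives (M Mᵀ)_{gh} = ψ(x, g) R(x) and
-- (Mᵀ M)_{gh} = ψ(g, y) C(y), with R, C the row and column sums of M; both vanish when x (resp. y) is an
-- involution with ψ(x, x) = -1. On D_m, with φ(g) the product of ψ(g, r) over the rotations r, taking
-- products of the cocycle identity (m odd) gives ψ = ∂φ, twisted by the character χ(g) = ∏ₖ ψ(g, k) when the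
-- second argument is a reflection. χ is trivial on rotations (they are squares), so if ψ is no coboundary,
-- χ = -1 on reflections and ψ(s, s) = -1 for every reflection s. When g, h have different parities, x and y are
-- reflections and both entries vanish; otherwise ψ = ∂φ along the rotations x and y, and both entries become
-- φ(g) φ(h) times the same correlation sum Σₖ φ(k) φ(k x).

module Submission where

open import Defs
open import Data.Nat using (ℕ; suc; _*_)
open import Data.Fin using (Fin)
open import Data.List using (map; allFin)
open import Data.Sign using (Sign)
open import Data.Product using (_×_; _,_)
open import Relation.Nullary using (¬_)
open import Relation.Binary.PropositionalEquality using (_≡_)
open import Algebra.Structures using (IsAbelianGroup)
open import Function.Bundles using (_⤖_; Bijection)

open import Level using (0ℓ)
open import Function using (id)
open import Data.Bool using (true; false)
open import Data.Product using (proj₁; proj₂)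
open import Data.Nat as ℕ using (zero; _∸_; _%_)
import Data.Nat.Properties as ℕP
open import Data.Nat.DivMod using (_mod_; m%n<n; m<n⇒m%n≡m; %-distribˡ-+; m%n%n≡m%n; n%n≡0; [m+kn]%n≡m%n)
open import Data.Nat.Divisibility using (_∣_; divides)
open import Data.Nat.Tactic.RingSolver using (solve-∀)
open import Data.Integer as ℤ using (ℤ; 0ℤ; 1ℤ; -1ℤ; ∣_∣)
import Data.Integer.Properties as ℤP
open import Data.Fin using (toℕ)
import Data.Fin as Fin
open import Data.Fin.Properties using (toℕ-fromℕ<; toℕ-injective; toℕ<n)
open import Data.Fin.Permutation using (permutation)
open import Data.List using ([]; _∷_; tabulate; concatMap)
open import Data.List.Properties using (map-cong; map-tabulate)
open import Data.Sign using (+; -; opposite) renaming (_*_ to _⊛_)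
import Data.Sign.Properties
open import Data.Sign.Properties using (_≟_; s*s≡+; *-comm; *-assoc; *-identityʳ)
open import Algebra.Bundles using (CommutativeMonoid; Group; AbelianGroup)
open import Algebra.Structures using (IsCommutativeMonoid)
import Algebra.Properties.AbelianGroup
import Algebra.Properties.CommutativeMonoid.Sum as CommutativeMonoidSum
import Algebra.Properties.CommutativeSemigroup
import Algebra.Properties.Group
import Algebra.Properties.Monoid.Mult
open import Algebra.Properties.Semiring.Sum ℤP.+-*-semiring using (*-distribˡ-sum)
open Algebra.Properties.CommutativeSemigroup Data.Sign.Properties.*-commutativeSemigroup using (interchange; xy∙z≈y∙xz)
open import Relation.Nullary.Decidable using (Dec; map′; _×-dec_; _→-dec_; from-yes)
open import Relation.Nullary.Negation using (contradiction)
open import Relation.Binary.PropositionalEquality using (isEquivalence; refl; sym; trans; cong; cong₂; module ≡-Reasoning)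

∀±? : {P : Sign → Set} → (∀ s → Dec (P s)) → Dec (∀ s → P s)
∀±? P? = map′ (λ (p , q) → λ { + → p ; - → q }) (λ f → f + , f -) (P? + ×-dec P? -)

signToℤ-⊛ : ∀ s t → signToℤ (s ⊛ t) ≡ signToℤ s ℤ.* signToℤ t
signToℤ-⊛ s t = ℤP.◃-distrib-* s t 1 1

signToℤ-opposite : ∀ s → signToℤ (opposite s) ≡ ℤ.- signToℤ s
signToℤ-opposite + = refl
signToℤ-opposite - = refl

⊛-exchange : ∀ a b c d → a ⊛ b ≡ c ⊛ d → a ⊛ c ≡ b ⊛ d
⊛-exchange = from-yes (∀±? λ a → ∀±? λ b → ∀±? λ c → ∀±? λ d →
  (a ⊛ b ≟ c ⊛ d) →-dec (a ⊛ c ≟ b ⊛ d))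

⊛≡-⇒≡opposite : ∀ a b → a ⊛ b ≡ - → a ≡ opposite b
⊛≡-⇒≡opposite + - _ = refl
⊛≡-⇒≡opposite - + _ = refl

⊛-moveʳ : ∀ a b c → a ⊛ b ≡ c → a ≡ c ⊛ b
⊛-moveʳ = from-yes (∀±? λ a → ∀±? λ b → ∀±? λ c → (a ⊛ b ≟ c) →-dec (a ≟ c ⊛ b))

⊛≡+⇒≡ : ∀ a b → a ⊛ b ≡ + → a ≡ b
⊛≡+⇒≡ + + _ = refl
⊛≡+⇒≡ - - _ = refl

signToℤ-cancel : ∀ s t i → signToℤ (s ⊛ t) ℤ.* (signToℤ s ℤ.* i) ≡ signToℤ t ℤ.* i
signToℤ-cancel s t i = begin
  signToℤ (s ⊛ t) ℤ.* (signToℤ s ℤ.* i)   ≡⟨ sym (ℤP.*-assoc (signToℤ (s ⊛ t)) (signToℤ s) i) ⟩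
  signToℤ (s ⊛ t) ℤ.* signToℤ s ℤ.* i     ≡⟨ cong (ℤ._* i) (sym (signToℤ-⊛ (s ⊛ t) s)) ⟩
  signToℤ (s ⊛ t ⊛ s) ℤ.* i               ≡⟨ cong (λ u → signToℤ u ℤ.* i) (s*t*s≡t s t) ⟩
  signToℤ t ℤ.* i                         ∎
  where
  open ≡-Reasoning
  s*t*s≡t : ∀ s t → s ⊛ t ⊛ s ≡ t
  s*t*s≡t + + = refl
  s*t*s≡t + - = refl
  s*t*s≡t - + = refl
  s*t*s≡t - - = refl

i≡-i⇒i≡0 : ∀ i → i ≡ ℤ.- i → i ≡ 0ℤ
i≡-i⇒i≡0 (ℤ.+ 0) _ = refl

module FinSum {C : Set} {_∙_ : C → C → C} {ε : C} (isCommutativeMonoid : IsCommutativeMonoid _≡_ _∙_ ε) where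
  commutativeMonoid : CommutativeMonoid 0ℓ 0ℓ
  commutativeMonoid = record { isCommutativeMonoid = isCommutativeMonoid }

  open CommutativeMonoidSum commutativeMonoid public using (sum; sum-cong-≗; ∑-distrib-+; sum-replicate-zero; sum-replicate)
  open CommutativeMonoidSum commutativeMonoid using (sum-permute)

  sum-bijection : ∀ {n} (σ σ⁻¹ : Fin n → Fin n) → (∀ i → σ (σ⁻¹ i) ≡ i) → (∀ i → σ⁻¹ (σ i) ≡ i) →
                  (f : Fin n → C) → sum (λ i → f (σ i)) ≡ sum f
  sum-bijection σ σ⁻¹ inverseˡ inverseʳ f = sym (sum-permute f (permutation σ σ⁻¹ inverseˡ inverseʳ))

record InvariantSum {G : Set} (_·_ : G → G → G) : Set where
  field
    ∑            : (G → ℤ) → ℤ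
    ∑-cong       : ∀ {F F′ : G → ℤ} → (∀ k → F k ≡ F′ k) → ∑ F ≡ ∑ F′
    ∑-*ˡ         : ∀ c (F : G → ℤ) → ∑ (λ k → c ℤ.* F k) ≡ c ℤ.* ∑ F
    ∑-invariantˡ : ∀ g (F : G → ℤ) → ∑ (λ k → F (g · k)) ≡ ∑ F
    ∑-invariantʳ : ∀ g (F : G → ℤ) → ∑ (λ k → F (k · g)) ≡ ∑ F

  open ≡-Reasoning

  ∑-neg : ∀ (F : G → ℤ) → ∑ (λ k → ℤ.- F k) ≡ ℤ.- ∑ F
  ∑-neg F = begin
    ∑ (λ k → ℤ.- F k)      ≡⟨ ∑-cong (λ k → sym (ℤP.-1*i≡-i (F k))) ⟩
    ∑ (λ k → -1ℤ ℤ.* F k)  ≡⟨ ∑-*ˡ -1ℤ F ⟩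
    -1ℤ ℤ.* ∑ F            ≡⟨ ℤP.-1*i≡-i (∑ F) ⟩
    ℤ.- ∑ F                ∎

  ∑-antiˡ : ∀ a (F : G → ℤ) → (∀ k → F (a · k) ≡ ℤ.- F k) → ∑ F ≡ 0ℤ
  ∑-antiˡ a F anti = i≡-i⇒i≡0 (∑ F) (begin
    ∑ F                  ≡⟨ sym (∑-invariantˡ a F) ⟩
    ∑ (λ k → F (a · k))  ≡⟨ ∑-cong anti ⟩
    ∑ (λ k → ℤ.- F k)    ≡⟨ ∑-neg F ⟩
    ℤ.- ∑ F              ∎)

  ∑-antiʳ : ∀ a (F : G → ℤ) → (∀ k → F (k · a) ≡ ℤ.- F k) → ∑ F ≡ 0ℤ
  ∑-antiʳ a F anti = i≡-i⇒i≡0 (∑ F) (begin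
    ∑ F                  ≡⟨ sym (∑-invariantʳ a F) ⟩
    ∑ (λ k → F (k · a))  ≡⟨ ∑-cong anti ⟩
    ∑ (λ k → ℤ.- F k)    ≡⟨ ∑-neg F ⟩
    ℤ.- ∑ F              ∎)

  ∑-nontrivialCharacter : (χ : G → Sign) → (∀ x y → χ (x · y) ≡ χ x ⊛ χ y) →
                          ∀ a → χ a ≡ - → ∑ (λ k → signToℤ (χ k)) ≡ 0ℤ
  ∑-nontrivialCharacter χ χ-hom a χa≡- = ∑-antiˡ a (λ k → signToℤ (χ k)) λ k →
    trans (cong signToℤ (trans (χ-hom a k) (cong (_⊛ χ k) χa≡-))) (signToℤ-opposite (χ k))

  ∑-symmetricʳ : (w : G → G → ℤ) → (∀ k l → w k l ≡ w l k) →
                 ∀ y y′ → (∀ k → (k · y′) · y ≡ k) →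
                 ∑ (λ k → w k (k · y)) ≡ ∑ (λ k → w k (k · y′))
  ∑-symmetricʳ w w-sym y y′ cancel = begin
    ∑ (λ k → w k (k · y))                ≡⟨ sym (∑-invariantʳ y′ (λ k → w k (k · y))) ⟩
    ∑ (λ k → w (k · y′) ((k · y′) · y))  ≡⟨ ∑-cong (λ k → trans (cong (w (k · y′)) (cancel k)) (w-sym _ _)) ⟩
    ∑ (λ k → w k (k · y′))               ∎

-- Row and column sums of a normalized cocycle

module CocycleSums {G : Set} {_·_ : G → G → G} {e : G} {ψ : G → G → Sign}
  (cocycle : IsNormalizedCocycle _·_ e ψ)
  (identityˡ : ∀ k → e · k ≡ k) (identityʳ : ∀ k → k · e ≡ k) where

  open ≡-Reasoning
  private
    ψee≡+ = proj₁ cocycle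
    ψ-cocycle = proj₂ cocycle

  ψ-identityˡ : ∀ k → ψ e k ≡ +
  ψ-identityˡ k = begin
    ψ e k                  ≡⟨ cong (λ x → ψ x k) (sym (identityˡ e)) ⟩
    + ⊛ ψ (e · e) k        ≡⟨ cong (λ s → s ⊛ ψ (e · e) k) (sym ψee≡+) ⟩
    ψ e e ⊛ ψ (e · e) k    ≡⟨ ψ-cocycle e e k ⟩
    ψ e (e · k) ⊛ ψ e k    ≡⟨ cong (λ x → ψ e x ⊛ ψ e k) (identityˡ k) ⟩
    ψ e k ⊛ ψ e k          ≡⟨ s*s≡+ (ψ e k) ⟩
    +                      ∎

  ψ-identityʳ : ∀ k → ψ k e ≡ +
  ψ-identityʳ k = sym (begin
    +                      ≡⟨ sym (s*s≡+ (ψ k e)) ⟩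
    ψ k e ⊛ ψ k e          ≡⟨ cong (λ x → ψ k e ⊛ ψ x e) (sym (identityʳ k)) ⟩
    ψ k e ⊛ ψ (k · e) e    ≡⟨ ψ-cocycle k e e ⟩
    ψ k (e · e) ⊛ ψ e e    ≡⟨ cong₂ (λ x s → ψ k x ⊛ s) (identityˡ e) ψee≡+ ⟩
    ψ k e ⊛ +              ≡⟨ *-identityʳ (ψ k e) ⟩
    ψ k e                  ∎)

  coboundary : (G → Sign) → G → G → Sign
  coboundary φ g h = φ g ⊛ φ h ⊛ φ (g · h)

  module Sums (S : InvariantSum _·_) where
    open InvariantSum S

    rowSum colSum : G → ℤ
    rowSum x = ∑ (λ k → signToℤ (ψ x k))
    colSum y = ∑ (λ k → signToℤ (ψ k y))

    rowProduct colProduct : G → G → ℤ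
    rowProduct g h = ∑ (λ k → signToℤ (ψ g k) ℤ.* signToℤ (ψ h k))
    colProduct g h = ∑ (λ k → signToℤ (ψ k g) ℤ.* signToℤ (ψ k h))

    rowProduct-translate : ∀ {x g h} → x · g ≡ h → rowProduct g h ≡ signToℤ (ψ x g) ℤ.* rowSum x
    rowProduct-translate {x} {g} {h} xg≡h = begin
      ∑ (λ k → signToℤ (ψ g k) ℤ.* signToℤ (ψ h k))            ≡⟨ ∑-cong summand ⟩
      ∑ (λ k → signToℤ (ψ x g) ℤ.* signToℤ (ψ x (g · k)))      ≡⟨ ∑-*ˡ (signToℤ (ψ x g)) (λ k → signToℤ (ψ x (g · k))) ⟩
      signToℤ (ψ x g) ℤ.* ∑ (λ k → signToℤ (ψ x (g · k)))      ≡⟨ cong (signToℤ (ψ x g) ℤ.*_) (∑-invariantˡ g (λ k → signToℤ (ψ x k))) ⟩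
      signToℤ (ψ x g) ℤ.* rowSum x                              ∎
      where
      summand : ∀ k → signToℤ (ψ g k) ℤ.* signToℤ (ψ h k) ≡ signToℤ (ψ x g) ℤ.* signToℤ (ψ x (g · k))
      summand k = begin
        signToℤ (ψ g k) ℤ.* signToℤ (ψ h k)        ≡⟨ sym (signToℤ-⊛ (ψ g k) (ψ h k)) ⟩
        signToℤ (ψ g k ⊛ ψ h k)                    ≡⟨ cong signToℤ (*-comm (ψ g k) (ψ h k)) ⟩
        signToℤ (ψ h k ⊛ ψ g k)                    ≡⟨ cong signToℤ (sym (⊛-exchange (ψ x g) (ψ h k) (ψ x (g · k)) (ψ g k) cocycle-xgk)) ⟩
        signToℤ (ψ x g ⊛ ψ x (g · k))              ≡⟨ signToℤ-⊛ (ψ x g) (ψ x (g · k)) ⟩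
        signToℤ (ψ x g) ℤ.* signToℤ (ψ x (g · k))  ∎
        where
        cocycle-xgk : ψ x g ⊛ ψ h k ≡ ψ x (g · k) ⊛ ψ g k
        cocycle-xgk = trans (cong (λ z → ψ x g ⊛ ψ z k) (sym xg≡h)) (ψ-cocycle x g k)

    colProduct-translate : ∀ {y g h} → g · y ≡ h → colProduct g h ≡ signToℤ (ψ g y) ℤ.* colSum y
    colProduct-translate {y} {g} {h} gy≡h = begin
      ∑ (λ k → signToℤ (ψ k g) ℤ.* signToℤ (ψ k h))            ≡⟨ ∑-cong summand ⟩
      ∑ (λ k → signToℤ (ψ g y) ℤ.* signToℤ (ψ (k · g) y))      ≡⟨ ∑-*ˡ (signToℤ (ψ g y)) (λ k → signToℤ (ψ (k · g) y)) ⟩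
      signToℤ (ψ g y) ℤ.* ∑ (λ k → signToℤ (ψ (k · g) y))      ≡⟨ cong (signToℤ (ψ g y) ℤ.*_) (∑-invariantʳ g (λ k → signToℤ (ψ k y))) ⟩
      signToℤ (ψ g y) ℤ.* colSum y                              ∎
      where
      summand : ∀ k → signToℤ (ψ k g) ℤ.* signToℤ (ψ k h) ≡ signToℤ (ψ g y) ℤ.* signToℤ (ψ (k · g) y)
      summand k = begin
        signToℤ (ψ k g) ℤ.* signToℤ (ψ k h)        ≡⟨ sym (signToℤ-⊛ (ψ k g) (ψ k h)) ⟩
        signToℤ (ψ k g ⊛ ψ k h)                    ≡⟨ cong signToℤ (⊛-exchange (ψ k g) (ψ (k · g) y) (ψ k h) (ψ g y) cocycle-kgy) ⟩
        signToℤ (ψ (k · g) y ⊛ ψ g y)              ≡⟨ cong signToℤ (*-comm (ψ (k · g) y) (ψ g y)) ⟩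
        signToℤ (ψ g y ⊛ ψ (k · g) y)              ≡⟨ signToℤ-⊛ (ψ g y) (ψ (k · g) y) ⟩
        signToℤ (ψ g y) ℤ.* signToℤ (ψ (k · g) y)  ∎
        where
        cocycle-kgy : ψ k g ⊛ ψ (k · g) y ≡ ψ k h ⊛ ψ g y
        cocycle-kgy = trans (ψ-cocycle k g y) (cong (λ z → ψ k z ⊛ ψ g y) gy≡h)

    rowSum-involution : ∀ {x} → x · x ≡ e → ψ x x ≡ - → rowSum x ≡ 0ℤ
    rowSum-involution {x} xx≡e ψxx≡- = ∑-antiˡ x (λ k → signToℤ (ψ x k)) λ k →
      trans (cong signToℤ (⊛≡-⇒≡opposite (ψ x (x · k)) (ψ x k) (sym (begin
        -                        ≡⟨ cong₂ (λ s t → s ⊛ t) (sym ψxx≡-) (sym (ψ-identityˡ k)) ⟩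
        ψ x x ⊛ ψ e k            ≡⟨ cong (λ z → ψ x x ⊛ ψ z k) (sym xx≡e) ⟩
        ψ x x ⊛ ψ (x · x) k      ≡⟨ ψ-cocycle x x k ⟩
        ψ x (x · k) ⊛ ψ x k      ∎))))
        (signToℤ-opposite (ψ x k))

    colSum-involution : ∀ {y} → y · y ≡ e → ψ y y ≡ - → colSum y ≡ 0ℤ
    colSum-involution {y} yy≡e ψyy≡- = ∑-antiʳ y (λ k → signToℤ (ψ k y)) λ k →
      trans (cong signToℤ (⊛≡-⇒≡opposite (ψ (k · y) y) (ψ k y) (begin
        ψ (k · y) y ⊛ ψ k y      ≡⟨ *-comm (ψ (k · y) y) _ ⟩
        ψ k y ⊛ ψ (k · y) y      ≡⟨ ψ-cocycle k y y ⟩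
        ψ k (y · y) ⊛ ψ y y      ≡⟨ cong₂ (λ z s → ψ k z ⊛ s) yy≡e ψyy≡- ⟩
        ψ k e ⊛ -                ≡⟨ cong (_⊛ -) (ψ-identityʳ k) ⟩
        -                        ∎)))
        (signToℤ-opposite (ψ k y))

    module Coboundary (φ : G → Sign) where

      correlation : G → G → ℤ
      correlation k l = signToℤ (φ k ⊛ φ l)

      leftCorrelation rightCorrelation : G → ℤ
      leftCorrelation x  = ∑ (λ k → correlation k (x · k))
      rightCorrelation y = ∑ (λ k → correlation k (k · y))

      rowProduct-coboundary : ∀ {x g h} → x · g ≡ h → (∀ k → ψ x k ≡ coboundary φ x k) →
                              rowProduct g h ≡ signToℤ (φ g ⊛ φ h) ℤ.* leftCorrelation x
      rowProduct-coboundary {x} {g} {h} xg≡h ψx≡∂φx = begin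
        rowProduct g h                                                   ≡⟨ rowProduct-translate xg≡h ⟩
        signToℤ (ψ x g) ℤ.* rowSum x                                     ≡⟨ cong₂ ℤ._*_ (cong signToℤ ψxg) rowSum≡ ⟩
        signToℤ (φ x ⊛ (φ g ⊛ φ h)) ℤ.* (signToℤ (φ x) ℤ.* leftCorrelation x) ≡⟨ signToℤ-cancel (φ x) (φ g ⊛ φ h) (leftCorrelation x) ⟩
        signToℤ (φ g ⊛ φ h) ℤ.* leftCorrelation x                       ∎
        where
        ψxg : ψ x g ≡ φ x ⊛ (φ g ⊛ φ h)
        ψxg = trans (ψx≡∂φx g) (trans (cong (λ z → φ x ⊛ φ g ⊛ φ z) xg≡h) (*-assoc (φ x) (φ g) (φ h)))
        rowSum≡ : rowSum x ≡ signToℤ (φ x) ℤ.* leftCorrelation x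
        rowSum≡ = trans (∑-cong (λ k → trans (cong signToℤ (trans (ψx≡∂φx k) (*-assoc (φ x) (φ k) (φ (x · k)))))
                                             (signToℤ-⊛ (φ x) (φ k ⊛ φ (x · k)))))
                        (∑-*ˡ (signToℤ (φ x)) (λ k → correlation k (x · k)))

      colProduct-coboundary : ∀ {y g h} → g · y ≡ h → (∀ k → ψ k y ≡ coboundary φ k y) →
                              colProduct g h ≡ signToℤ (φ g ⊛ φ h) ℤ.* rightCorrelation y
      colProduct-coboundary {y} {g} {h} gy≡h ψ·y≡∂φ·y = begin
        colProduct g h                                                   ≡⟨ colProduct-translate gy≡h ⟩
        signToℤ (ψ g y) ℤ.* colSum y                                     ≡⟨ cong₂ ℤ._*_ (cong signToℤ ψgy) colSum≡ ⟩
        signToℤ (φ y ⊛ (φ g ⊛ φ h)) ℤ.* (signToℤ (φ y) ℤ.* rightCorrelation y) ≡⟨ signToℤ-cancel (φ y) (φ g ⊛ φ h) (rightCorrelation y) ⟩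
        signToℤ (φ g ⊛ φ h) ℤ.* rightCorrelation y                      ∎
        where
        ψgy : ψ g y ≡ φ y ⊛ (φ g ⊛ φ h)
        ψgy = trans (ψ·y≡∂φ·y g) (trans (cong (λ z → φ g ⊛ φ y ⊛ φ z) gy≡h) (xy∙z≈y∙xz (φ g) (φ y) (φ h)))
        colSum≡ : colSum y ≡ signToℤ (φ y) ℤ.* rightCorrelation y
        colSum≡ = trans (∑-cong (λ k → trans (cong signToℤ (trans (ψ·y≡∂φ·y k) (xy∙z≈y∙xz (φ k) (φ y) (φ (k · y)))))
                                             (signToℤ-⊛ (φ y) (φ k ⊛ φ (k · y)))))
                        (∑-*ˡ (signToℤ (φ y)) (λ k → correlation k (k · y)))


-- Abelian groups

4∤2[2n+1] : ∀ n → ¬ 4 ∣ 2 * suc (2 * n)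
4∤2[2n+1] n (divides q 2[2n+1]≡q*4) =
  ℕP.even≢odd q n (sym (ℕP.*-cancelˡ-≡ (suc (2 * n)) (2 * q) 2 (trans 2[2n+1]≡q*4 (q*4≡2*[2*q] q))))
  where
  q*4≡2*[2*q] : ∀ q → q * 4 ≡ 2 * (2 * q)
  q*4≡2*[2*q] = solve-∀

module EnumeratedAbelianGroup {A : Set} {_∙_ : A → A → A} {e : A} {inv : A → A}
  (isAbelianGroup : IsAbelianGroup _≡_ _∙_ e inv) {N : ℕ} (enumeration : Fin N ⤖ A) where

  open IsAbelianGroup isAbelianGroup using (comm; isGroup)
  group : Group 0ℓ 0ℓ
  group = record { isGroup = isGroup }

  open Algebra.Properties.Group group using (\\-leftDividesˡ; \\-leftDividesʳ)
  open Bijection enumeration using (to; injective; surjective)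
  open FinSum ℤP.+-0-isCommutativeMonoid
  open ≡-Reasoning

  from : A → Fin N
  from y = proj₁ (surjective y)

  to-from : ∀ y → to (from y) ≡ y
  to-from y = proj₂ (surjective y) refl

  from-to : ∀ i → from (to i) ≡ i
  from-to i = injective (to-from (to i))

  ∑A : (A → ℤ) → ℤ
  ∑A F = sum (λ i → F (to i))

  ∑A-translateˡ : ∀ g (F : A → ℤ) → ∑A (λ k → F (g ∙ k)) ≡ ∑A F
  ∑A-translateˡ g F = begin
    sum (λ i → F (g ∙ to i))        ≡⟨ sum-cong-≗ (λ i → cong F (sym (to-from (g ∙ to i)))) ⟩
    sum (λ i → F (to (σ i)))        ≡⟨ sum-bijection σ σ⁻¹ σσ⁻¹ σ⁻¹σ (λ i → F (to i)) ⟩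
    sum (λ i → F (to i))            ∎
    where
    σ σ⁻¹ : Fin N → Fin N
    σ i = from (g ∙ to i)
    σ⁻¹ i = from (inv g ∙ to i)
    σσ⁻¹ : ∀ i → σ (σ⁻¹ i) ≡ i
    σσ⁻¹ i = trans (cong (λ y → from (g ∙ y)) (to-from _)) (trans (cong from (\\-leftDividesˡ g (to i))) (from-to i))
    σ⁻¹σ : ∀ i → σ⁻¹ (σ i) ≡ i
    σ⁻¹σ i = trans (cong (λ y → from (inv g ∙ y)) (to-from _)) (trans (cong from (\\-leftDividesʳ g (to i))) (from-to i))

  invariantSum : InvariantSum _∙_
  invariantSum = record
    { ∑            = ∑A
    ; ∑-cong       = λ F≗F′ → sum-cong-≗ (λ i → F≗F′ (to i))
    ; ∑-*ˡ         = λ c F → sym (*-distribˡ-sum c (λ i → F (to i)))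
    ; ∑-invariantˡ = ∑A-translateˡ
    ; ∑-invariantʳ = λ g F → trans (sum-cong-≗ (λ i → cong F (comm (to i) g))) (∑A-translateˡ g F)
    }

  ∑A-one : ∑A (λ _ → 1ℤ) ≡ ℤ.+ N
  ∑A-one = sum-one N
    where
    sum-one : ∀ n → sum {n} (λ _ → 1ℤ) ≡ ℤ.+ n
    sum-one zero    = refl
    sum-one (suc n) = cong (λ x → 1ℤ ℤ.+ x) (sum-one n)

  bothTrivial : Sign → Sign → ℕ
  bothTrivial + + = 1
  bothTrivial _ _ = 0

  expand-[1+s][1+t] : ∀ s t → 1ℤ ℤ.+ signToℤ s ℤ.+ signToℤ t ℤ.+ signToℤ (s ⊛ t) ≡ ℤ.+ 4 ℤ.* ℤ.+ bothTrivial s t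
  expand-[1+s][1+t] + + = refl
  expand-[1+s][1+t] + - = refl
  expand-[1+s][1+t] - + = refl
  expand-[1+s][1+t] - - = refl

  -- Σ (1 + χ₁)(1 + χ₂) = |A| since the nontrivial characters χ₁, χ₂, χ₁χ₂ sum to 0, and each summand is 0 or 4.
  4∣order : (χ₁ χ₂ : A → Sign) → (∀ x y → χ₁ (x ∙ y) ≡ χ₁ x ⊛ χ₁ y) → (∀ x y → χ₂ (x ∙ y) ≡ χ₂ x ⊛ χ₂ y) →
            ∀ a b c → χ₁ a ≡ - → χ₂ b ≡ - → χ₁ c ⊛ χ₂ c ≡ - → 4 ∣ N
  4∣order χ₁ χ₂ χ₁-hom χ₂-hom a b c χ₁a≡- χ₂b≡- χ₁₂c≡- = divides ∣ K ∣ (begin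
    N                       ≡⟨ cong ∣_∣ counting ⟩
    ∣ ℤ.+ 4 ℤ.* K ∣         ≡⟨ ℤP.abs-* (ℤ.+ 4) K ⟩
    4 ℕ.* ∣ K ∣             ≡⟨ ℕP.*-comm 4 ∣ K ∣ ⟩
    ∣ K ∣ ℕ.* 4             ∎)
    where
    open InvariantSum invariantSum using (∑-nontrivialCharacter)
    χ₁₂ : A → Sign
    χ₁₂ x = χ₁ x ⊛ χ₂ x
    χ₁₂-hom : ∀ x y → χ₁₂ (x ∙ y) ≡ χ₁₂ x ⊛ χ₁₂ y
    χ₁₂-hom x y = trans (cong₂ _⊛_ (χ₁-hom x y) (χ₂-hom x y)) (interchange (χ₁ x) (χ₁ y) (χ₂ x) (χ₂ y))
    one s t u : Fin N → ℤ
    one _ = 1ℤ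
    s i = signToℤ (χ₁ (to i))
    t i = signToℤ (χ₂ (to i))
    u i = signToℤ (χ₁₂ (to i))
    K : ℤ
    K = ∑A (λ k → ℤ.+ bothTrivial (χ₁ k) (χ₂ k))
    total : sum (λ i → 1ℤ ℤ.+ s i ℤ.+ t i ℤ.+ u i) ≡ ℤ.+ N
    total = begin
      sum (λ i → 1ℤ ℤ.+ s i ℤ.+ t i ℤ.+ u i)          ≡⟨ ∑-distrib-+ (λ i → 1ℤ ℤ.+ s i ℤ.+ t i) u ⟩
      sum (λ i → 1ℤ ℤ.+ s i ℤ.+ t i) ℤ.+ sum u        ≡⟨ cong (ℤ._+ sum u) (∑-distrib-+ (λ i → 1ℤ ℤ.+ s i) t) ⟩
      sum (λ i → 1ℤ ℤ.+ s i) ℤ.+ sum t ℤ.+ sum u      ≡⟨ cong (λ x → x ℤ.+ sum t ℤ.+ sum u) (∑-distrib-+ one s) ⟩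
      sum one ℤ.+ sum s ℤ.+ sum t ℤ.+ sum u           ≡⟨ cong₂ ℤ._+_ (cong₂ ℤ._+_ (cong₂ ℤ._+_ ∑A-one ∑s≡0) ∑t≡0) ∑u≡0 ⟩
      ℤ.+ N ℤ.+ 0ℤ ℤ.+ 0ℤ ℤ.+ 0ℤ                       ≡⟨ cong ℤ.+_ (trans (ℕP.+-identityʳ _) (trans (ℕP.+-identityʳ _) (ℕP.+-identityʳ N))) ⟩
      ℤ.+ N                                           ∎
      where
      ∑s≡0 = ∑-nontrivialCharacter χ₁ χ₁-hom a χ₁a≡-
      ∑t≡0 = ∑-nontrivialCharacter χ₂ χ₂-hom b χ₂b≡-
      ∑u≡0 = ∑-nontrivialCharacter χ₁₂ χ₁₂-hom c χ₁₂c≡-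
    counting : ℤ.+ N ≡ ℤ.+ 4 ℤ.* K
    counting = begin
      ℤ.+ N                                                           ≡⟨ sym total ⟩
      sum (λ i → 1ℤ ℤ.+ s i ℤ.+ t i ℤ.+ u i)                          ≡⟨ sum-cong-≗ (λ i → expand-[1+s][1+t] (χ₁ (to i)) (χ₂ (to i))) ⟩
      sum (λ i → ℤ.+ 4 ℤ.* ℤ.+ bothTrivial (χ₁ (to i)) (χ₂ (to i)))   ≡⟨ sym (*-distribˡ-sum (ℤ.+ 4) (λ i → ℤ.+ bothTrivial (χ₁ (to i)) (χ₂ (to i)))) ⟩
      ℤ.+ 4 ℤ.* K                                                     ∎

  module _ {ψ : A → A → Sign} (cocycle : IsNormalizedCocycle _∙_ e ψ) where

    commutator : A → A → Sign
    commutator x y = ψ x y ⊛ ψ y x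

    commutator-multiplicativeˡ : ∀ x y k → commutator (x ∙ y) k ≡ commutator x k ⊛ commutator y k
    commutator-multiplicativeˡ x y k = signIdentity
        (ψ x y) (ψ (x ∙ y) k) (ψ x (y ∙ k)) (ψ y k) (ψ x k) (ψ (x ∙ k) y) (ψ k y) (ψ k x) (ψ k (x ∙ y))
      (proj₂ cocycle x y k)
      (trans (proj₂ cocycle x k y) (cong (λ z → ψ x z ⊛ ψ k y) (comm k y)))
      (trans (cong (λ z → ψ k x ⊛ ψ z y) (comm x k)) (proj₂ cocycle k x y))
      where
      signIdentity : ∀ a b c d u v p q r → a ⊛ b ≡ c ⊛ d → u ⊛ v ≡ c ⊛ p → q ⊛ v ≡ r ⊛ a →
                     b ⊛ r ≡ (u ⊛ q) ⊛ (d ⊛ p)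
      signIdentity = from-yes (∀±? λ a → ∀±? λ b → ∀±? λ c → ∀±? λ d → ∀±? λ u → ∀±? λ v →
        ∀±? λ p → ∀±? λ q → ∀±? λ r →
        (a ⊛ b ≟ c ⊛ d) →-dec (u ⊛ v ≟ c ⊛ p) →-dec (q ⊛ v ≟ r ⊛ a) →-dec (b ⊛ r ≟ (u ⊛ q) ⊛ (d ⊛ p)))

    commutator-trivial : ¬ 4 ∣ N → ∀ g h → commutator g h ≡ +
    commutator-trivial 4∤N g h with commutator g h in [g,h]≡-
    ... | + = refl
    ... | - = contradiction (4∣order χ₁ χ₂ (λ x y → commutator-multiplicativeˡ x y g) (λ x y → commutator-multiplicativeˡ x y h)
                               h g g (trans (*-comm (ψ h g) (ψ g h)) [g,h]≡-) [g,h]≡- [g,g][g,h]≡-) 4∤N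
      where
      χ₁ χ₂ : A → Sign
      χ₁ x = commutator x g
      χ₂ x = commutator x h
      [g,g][g,h]≡- : commutator g g ⊛ commutator g h ≡ -
      [g,g][g,h]≡- = cong₂ _⊛_ (s*s≡+ (ψ g g)) [g,h]≡-

    ψ-symmetric : ¬ 4 ∣ N → ∀ g h → ψ g h ≡ ψ h g
    ψ-symmetric 4∤N g h = ⊛≡+⇒≡ (ψ g h) (ψ h g) (commutator-trivial 4∤N g h)

    normal : ¬ 4 ∣ N → IsNormalMatrix (map to (allFin N)) ψ
    normal 4∤N g h = cong sumℤ (map-cong (λ k → cong₂ ℤ._*_ (cong signToℤ (ψ-symmetric 4∤N g k)) (cong signToℤ (ψ-symmetric 4∤N h k))) (map to (allFin N)))

-- The cyclic group ℤ/m, m = suc k, on Fin m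

module Cyclic (k : ℕ) where

  m : ℕ
  m = suc k

  _+ₘ_ _-ₘ_ : Fin m → Fin m → Fin m
  i +ₘ j = (toℕ i ℕ.+ toℕ j) mod m
  i -ₘ j = (toℕ i ℕ.+ (m ∸ toℕ j)) mod m

  0ₘ : Fin m
  0ₘ = 0 mod m

  negₘ : Fin m → Fin m
  negₘ j = (m ∸ toℕ j) mod m

  open ≡-Reasoning

  toℕ-mod : ∀ a → toℕ (a mod m) ≡ a % m
  toℕ-mod a = toℕ-fromℕ< (m%n<n a m)

  mod-cong : ∀ a b → a % m ≡ b % m → a mod m ≡ b mod m
  mod-cong a b eq = toℕ-injective (trans (toℕ-mod a) (trans eq (sym (toℕ-mod b))))

  toℕ-mod-id : ∀ i → toℕ i mod m ≡ i
  toℕ-mod-id i = toℕ-injective (trans (toℕ-mod (toℕ i)) (m<n⇒m%n≡m (toℕ<n i)))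

  %-absorbˡ : ∀ a b → (a % m ℕ.+ b) % m ≡ (a ℕ.+ b) % m
  %-absorbˡ a b = begin
    (a % m ℕ.+ b) % m              ≡⟨ %-distribˡ-+ (a % m) b m ⟩
    (a % m % m ℕ.+ b % m) % m      ≡⟨ cong (λ x → (x ℕ.+ b % m) % m) (m%n%n≡m%n a m) ⟩
    (a % m ℕ.+ b % m) % m          ≡⟨ sym (%-distribˡ-+ a b m) ⟩
    (a ℕ.+ b) % m                  ∎

  %-absorbʳ : ∀ a b → (a ℕ.+ b % m) % m ≡ (a ℕ.+ b) % m
  %-absorbʳ a b = begin
    (a ℕ.+ b % m) % m   ≡⟨ cong (_% m) (ℕP.+-comm a (b % m)) ⟩
    (b % m ℕ.+ a) % m   ≡⟨ %-absorbˡ b a ⟩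
    (b ℕ.+ a) % m       ≡⟨ cong (_% m) (ℕP.+-comm b a) ⟩
    (a ℕ.+ b) % m       ∎

  +ₘ-assoc : ∀ i j l → (i +ₘ j) +ₘ l ≡ i +ₘ (j +ₘ l)
  +ₘ-assoc i j l = mod-cong (toℕ (i +ₘ j) ℕ.+ toℕ l) (toℕ i ℕ.+ toℕ (j +ₘ l)) (begin
    (toℕ (i +ₘ j) ℕ.+ toℕ l) % m            ≡⟨ cong (λ x → (x ℕ.+ toℕ l) % m) (toℕ-mod (toℕ i ℕ.+ toℕ j)) ⟩
    ((toℕ i ℕ.+ toℕ j) % m ℕ.+ toℕ l) % m   ≡⟨ %-absorbˡ (toℕ i ℕ.+ toℕ j) (toℕ l) ⟩
    (toℕ i ℕ.+ toℕ j ℕ.+ toℕ l) % m         ≡⟨ cong (_% m) (ℕP.+-assoc (toℕ i) (toℕ j) (toℕ l)) ⟩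
    (toℕ i ℕ.+ (toℕ j ℕ.+ toℕ l)) % m       ≡⟨ sym (%-absorbʳ (toℕ i) (toℕ j ℕ.+ toℕ l)) ⟩
    (toℕ i ℕ.+ (toℕ j ℕ.+ toℕ l) % m) % m   ≡⟨ cong (λ x → (toℕ i ℕ.+ x) % m) (sym (toℕ-mod (toℕ j ℕ.+ toℕ l))) ⟩
    (toℕ i ℕ.+ toℕ (j +ₘ l)) % m            ∎)

  +ₘ-comm : ∀ i j → i +ₘ j ≡ j +ₘ i
  +ₘ-comm i j = cong (_mod m) (ℕP.+-comm (toℕ i) (toℕ j))

  +ₘ-identityˡ : ∀ i → 0ₘ +ₘ i ≡ i
  +ₘ-identityˡ = toℕ-mod-id

  +ₘ-identityʳ : ∀ i → i +ₘ 0ₘ ≡ i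
  +ₘ-identityʳ i = trans (+ₘ-comm i 0ₘ) (+ₘ-identityˡ i)

  +ₘ-inverseˡ : ∀ j → negₘ j +ₘ j ≡ 0ₘ
  +ₘ-inverseˡ j = mod-cong (toℕ (negₘ j) ℕ.+ toℕ j) 0 (begin
    (toℕ (negₘ j) ℕ.+ toℕ j) % m       ≡⟨ cong (λ x → (x ℕ.+ toℕ j) % m) (toℕ-mod (m ∸ toℕ j)) ⟩
    ((m ∸ toℕ j) % m ℕ.+ toℕ j) % m  ≡⟨ %-absorbˡ (m ∸ toℕ j) (toℕ j) ⟩
    (m ∸ toℕ j ℕ.+ toℕ j) % m        ≡⟨ cong (_% m) (ℕP.m∸n+n≡m (ℕP.<⇒≤ (toℕ<n j))) ⟩
    m % m                            ≡⟨ n%n≡0 m ⟩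
    0                                ∎)

  +ₘ-inverseʳ : ∀ j → j +ₘ negₘ j ≡ 0ₘ
  +ₘ-inverseʳ j = trans (+ₘ-comm j (negₘ j)) (+ₘ-inverseˡ j)

  -ₘ-as-+ₘ : ∀ i j → i -ₘ j ≡ i +ₘ negₘ j
  -ₘ-as-+ₘ i j = mod-cong (toℕ i ℕ.+ (m ∸ toℕ j)) (toℕ i ℕ.+ toℕ (negₘ j)) (begin
    (toℕ i ℕ.+ (m ∸ toℕ j)) % m          ≡⟨ sym (%-absorbʳ (toℕ i) (m ∸ toℕ j)) ⟩
    (toℕ i ℕ.+ (m ∸ toℕ j) % m) % m      ≡⟨ cong (λ x → (toℕ i ℕ.+ x) % m) (sym (toℕ-mod (m ∸ toℕ j))) ⟩
    (toℕ i ℕ.+ toℕ (negₘ j)) % m           ∎)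

  isAbelianGroup : IsAbelianGroup _≡_ _+ₘ_ 0ₘ negₘ
  isAbelianGroup = record
    { isGroup = record
      { isMonoid = record
        { isSemigroup = record
          { isMagma = record { isEquivalence = isEquivalence ; ∙-cong = cong₂ _+ₘ_ }
          ; assoc = +ₘ-assoc
          }
        ; identity = +ₘ-identityˡ , +ₘ-identityʳ
        }
      ; inverse = +ₘ-inverseˡ , +ₘ-inverseʳ
      ; ⁻¹-cong = cong negₘ
      }
    ; comm = +ₘ-comm
    }

  abelianGroup : AbelianGroup 0ℓ 0ℓ
  abelianGroup = record { isAbelianGroup = isAbelianGroup }

  open Algebra.Properties.AbelianGroup abelianGroup
    using (\\-leftDividesˡ; \\-leftDividesʳ; //-rightDividesˡ; //-rightDividesʳ; ⁻¹-anti-homo‿-; ⁻¹-∙-comm; ε⁻¹≈ε)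

  +ₘ-cancelˡ : ∀ c i → negₘ c +ₘ (c +ₘ i) ≡ i
  +ₘ-cancelˡ = \\-leftDividesʳ

  +ₘ-cancelˡ′ : ∀ c i → c +ₘ (negₘ c +ₘ i) ≡ i
  +ₘ-cancelˡ′ = \\-leftDividesˡ

  -ₘ+ₘ-cancel : ∀ c i → (i -ₘ c) +ₘ c ≡ i
  -ₘ+ₘ-cancel c i = trans (cong (_+ₘ c) (-ₘ-as-+ₘ i c)) (//-rightDividesˡ c i)

  +ₘ-ₘ-cancel : ∀ c i → (i +ₘ c) -ₘ c ≡ i
  +ₘ-ₘ-cancel c i = trans (-ₘ-as-+ₘ (i +ₘ c) c) (//-rightDividesʳ c i)

  +ₘ-ₘ-cancelʳ : ∀ c i → (c +ₘ i) -ₘ c ≡ i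
  +ₘ-ₘ-cancelʳ c i = trans (cong (_-ₘ c) (+ₘ-comm c i)) (+ₘ-ₘ-cancel c i)

  +ₘ-ₘ-cancelˡ : ∀ c i → c +ₘ (i -ₘ c) ≡ i
  +ₘ-ₘ-cancelˡ c i = trans (+ₘ-comm c (i -ₘ c)) (-ₘ+ₘ-cancel c i)

  -ₘ-identityʳ : ∀ i → i -ₘ 0ₘ ≡ i
  -ₘ-identityʳ i = trans (-ₘ-as-+ₘ i 0ₘ) (trans (cong (i +ₘ_) ε⁻¹≈ε) (+ₘ-identityʳ i))

  -ₘ-ₘ-cancel : ∀ c i → c -ₘ (c -ₘ i) ≡ i
  -ₘ-ₘ-cancel c i = begin
    c -ₘ (c -ₘ i)                   ≡⟨ -ₘ-as-+ₘ c (c -ₘ i) ⟩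
    c +ₘ negₘ (c -ₘ i)              ≡⟨ cong (λ x → c +ₘ negₘ x) (-ₘ-as-+ₘ c i) ⟩
    c +ₘ negₘ (c +ₘ negₘ i)         ≡⟨ cong (c +ₘ_) (⁻¹-anti-homo‿- c i) ⟩
    c +ₘ (i +ₘ negₘ c)              ≡⟨ cong (c +ₘ_) (+ₘ-comm i (negₘ c)) ⟩
    c +ₘ (negₘ c +ₘ i)              ≡⟨ +ₘ-cancelˡ′ c i ⟩
    i                               ∎

  -ₘ-opposite : ∀ i j → (i -ₘ j) +ₘ (j -ₘ i) ≡ 0ₘ
  -ₘ-opposite i j = begin
    (i -ₘ j) +ₘ (j -ₘ i)                 ≡⟨ cong₂ _+ₘ_ (-ₘ-as-+ₘ i j) (-ₘ-as-+ₘ j i) ⟩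
    (i +ₘ negₘ j) +ₘ (j +ₘ negₘ i)       ≡⟨ cong ((i +ₘ negₘ j) +ₘ_) (sym (⁻¹-anti-homo‿- i j)) ⟩
    (i +ₘ negₘ j) +ₘ negₘ (i +ₘ negₘ j)  ≡⟨ +ₘ-inverseʳ (i +ₘ negₘ j) ⟩
    0ₘ                                   ∎

  +ₘ-shift-cancel : ∀ {a b} → b +ₘ a ≡ 0ₘ → ∀ l → (l +ₘ b) +ₘ a ≡ l
  +ₘ-shift-cancel {a} {b} b+a≡0 l = begin
    (l +ₘ b) +ₘ a     ≡⟨ +ₘ-assoc l b a ⟩
    l +ₘ (b +ₘ a)     ≡⟨ cong (l +ₘ_) b+a≡0 ⟩
    l +ₘ 0ₘ           ≡⟨ +ₘ-identityʳ l ⟩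
    l                 ∎

  -ₘ-shift-cancel : ∀ {a b} → b +ₘ a ≡ 0ₘ → ∀ l → (l -ₘ b) -ₘ a ≡ l
  -ₘ-shift-cancel {a} {b} b+a≡0 l = begin
    (l -ₘ b) -ₘ a                 ≡⟨ cong (_-ₘ a) (-ₘ-as-+ₘ l b) ⟩
    ((l +ₘ negₘ b) -ₘ a)          ≡⟨ -ₘ-as-+ₘ (l +ₘ negₘ b) a ⟩
    (l +ₘ negₘ b) +ₘ negₘ a       ≡⟨ +ₘ-assoc l (negₘ b) (negₘ a) ⟩
    l +ₘ (negₘ b +ₘ negₘ a)       ≡⟨ cong (l +ₘ_) (⁻¹-∙-comm b a) ⟩
    l +ₘ negₘ (b +ₘ a)            ≡⟨ cong (λ x → l +ₘ negₘ x) b+a≡0 ⟩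
    l +ₘ negₘ 0ₘ                  ≡⟨ cong (l +ₘ_) ε⁻¹≈ε ⟩
    l +ₘ 0ₘ                       ≡⟨ +ₘ-identityʳ l ⟩
    l                             ∎

-- The dihedral group of order 2m

module DihedralGroup (k : ℕ) where

  open Cyclic k public

  G : Set
  G = Dihedral m

  _·_ : G → G → G
  _·_ = dihMul m

  e : G
  e = dihOne m

  rot ref : Fin m → G
  rot i = (i , false)
  ref i = (i , true)

  open ≡-Reasoning

  ·-identityˡ : ∀ g → e · g ≡ g
  ·-identityˡ (i , b) = cong (_, b) (+ₘ-identityˡ i)

  ·-identityʳ : ∀ g → g · e ≡ g
  ·-identityʳ (i , false) = cong rot (+ₘ-identityʳ i)
  ·-identityʳ (i , true)  = cong ref (-ₘ-identityʳ i)

  ref-involution : ∀ c → ref c · ref c ≡ e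
  ref-involution c = cong rot (trans (-ₘ-as-+ₘ c c) (+ₘ-inverseʳ c))

  rot·ref0 : ∀ c → rot c · ref 0ₘ ≡ ref c
  rot·ref0 c = cong ref (+ₘ-identityʳ c)

  ·rot-cancel : ∀ a b → b +ₘ a ≡ 0ₘ → ∀ k → (k · rot b) · rot a ≡ k
  ·rot-cancel a b b+a≡0 (l , false) = cong rot (+ₘ-shift-cancel {a} {b} b+a≡0 l)
  ·rot-cancel a b b+a≡0 (l , true)  = cong ref (-ₘ-shift-cancel {a} {b} b+a≡0 l)

  module DihedralSum {C : Set} {_∙_ : C → C → C} {ε : C} (isCommutativeMonoid : IsCommutativeMonoid _≡_ _∙_ ε) where

    open FinSum isCommutativeMonoid public
    open IsCommutativeMonoid isCommutativeMonoid using () renaming (comm to ∙-comm)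

    ∑G : (G → C) → C
    ∑G F = sum (λ i → F (rot i) ∙ F (ref i))

    sum-+ₘˡ : ∀ c (f : Fin m → C) → sum (λ i → f (c +ₘ i)) ≡ sum f
    sum-+ₘˡ c = sum-bijection (c +ₘ_) (negₘ c +ₘ_) (+ₘ-cancelˡ′ c) (+ₘ-cancelˡ c)

    sum-+ₘʳ : ∀ c (f : Fin m → C) → sum (λ i → f (i +ₘ c)) ≡ sum f
    sum-+ₘʳ c = sum-bijection (_+ₘ c) (_-ₘ c) (-ₘ+ₘ-cancel c) (+ₘ-ₘ-cancel c)

    sum--ₘˡ : ∀ c (f : Fin m → C) → sum (λ i → f (c -ₘ i)) ≡ sum f
    sum--ₘˡ c = sum-bijection (c -ₘ_) (c -ₘ_) (-ₘ-ₘ-cancel c) (-ₘ-ₘ-cancel c)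

    sum--ₘʳ : ∀ c (f : Fin m → C) → sum (λ i → f (i -ₘ c)) ≡ sum f
    sum--ₘʳ c = sum-bijection (_-ₘ c) (_+ₘ c) (+ₘ-ₘ-cancel c) (-ₘ+ₘ-cancel c)

    ∑G-invariantˡ : ∀ g (F : G → C) → ∑G (λ k → F (g · k)) ≡ ∑G F
    ∑G-invariantˡ (c , false) F = sum-+ₘˡ c (λ i → F (rot i) ∙ F (ref i))
    ∑G-invariantˡ (c , true)  F = begin
      sum (λ i → F (ref (c -ₘ i)) ∙ F (rot (c -ₘ i)))  ≡⟨ sum-cong-≗ (λ i → ∙-comm (F (ref (c -ₘ i))) (F (rot (c -ₘ i)))) ⟩
      sum (λ i → F (rot (c -ₘ i)) ∙ F (ref (c -ₘ i)))  ≡⟨ sum--ₘˡ c (λ i → F (rot i) ∙ F (ref i)) ⟩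
      ∑G F                                             ∎

    ∑G-invariantʳ : ∀ g (F : G → C) → ∑G (λ k → F (k · g)) ≡ ∑G F
    ∑G-invariantʳ (c , false) F = begin
      sum (λ i → F (rot (i +ₘ c)) ∙ F (ref (i -ₘ c)))               ≡⟨ ∑-distrib-+ (λ i → F (rot (i +ₘ c))) (λ i → F (ref (i -ₘ c))) ⟩
      sum (λ i → F (rot (i +ₘ c))) ∙ sum (λ i → F (ref (i -ₘ c)))   ≡⟨ cong₂ _∙_ (sum-+ₘʳ c (λ i → F (rot i))) (sum--ₘʳ c (λ i → F (ref i))) ⟩
      sum (λ i → F (rot i)) ∙ sum (λ i → F (ref i))                 ≡⟨ sym (∑-distrib-+ (λ i → F (rot i)) (λ i → F (ref i))) ⟩
      ∑G F                                                          ∎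
    ∑G-invariantʳ (c , true)  F = begin
      sum (λ i → F (ref (i +ₘ c)) ∙ F (rot (i -ₘ c)))               ≡⟨ ∑-distrib-+ (λ i → F (ref (i +ₘ c))) (λ i → F (rot (i -ₘ c))) ⟩
      sum (λ i → F (ref (i +ₘ c))) ∙ sum (λ i → F (rot (i -ₘ c)))   ≡⟨ cong₂ _∙_ (sum-+ₘʳ c (λ i → F (ref i))) (sum--ₘʳ c (λ i → F (rot i))) ⟩
      sum (λ i → F (ref i)) ∙ sum (λ i → F (rot i))                 ≡⟨ ∙-comm (sum (λ i → F (ref i))) (sum (λ i → F (rot i))) ⟩
      sum (λ i → F (rot i)) ∙ sum (λ i → F (ref i))                 ≡⟨ sym (∑-distrib-+ (λ i → F (rot i)) (λ i → F (ref i))) ⟩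
      ∑G F                                                          ∎

    ∑G-distrib : ∀ (F F′ : G → C) → ∑G (λ k → F k ∙ F′ k) ≡ ∑G F ∙ ∑G F′
    ∑G-distrib F F′ = begin
      sum (λ i → (F (rot i) ∙ F′ (rot i)) ∙ (F (ref i) ∙ F′ (ref i)))   ≡⟨ sum-cong-≗ (λ i → interchangeC (F (rot i)) (F′ (rot i)) (F (ref i)) (F′ (ref i))) ⟩
      sum (λ i → (F (rot i) ∙ F (ref i)) ∙ (F′ (rot i) ∙ F′ (ref i)))   ≡⟨ ∑-distrib-+ (λ i → F (rot i) ∙ F (ref i)) (λ i → F′ (rot i) ∙ F′ (ref i)) ⟩
      ∑G F ∙ ∑G F′                                                      ∎
      where open Algebra.Properties.CommutativeSemigroup (CommutativeMonoid.commutativeSemigroup commutativeMonoid)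
              using () renaming (interchange to interchangeC)

  module ∑ℤ = DihedralSum ℤP.+-0-isCommutativeMonoid
  module ∏± = DihedralSum Data.Sign.Properties.*-isCommutativeMonoid

  invariantSum : InvariantSum _·_
  invariantSum = record
    { ∑            = ∑G
    ; ∑-cong       = λ F≗F′ → sum-cong-≗ (λ i → cong₂ ℤ._+_ (F≗F′ (rot i)) (F≗F′ (ref i)))
    ; ∑-*ˡ         = λ c F → trans (sum-cong-≗ (λ i → sym (ℤP.*-distribˡ-+ c (F (rot i)) (F (ref i)))))
                                   (sym (*-distribˡ-sum c (λ i → F (rot i) ℤ.+ F (ref i))))
    ; ∑-invariantˡ = ∑G-invariantˡ
    ; ∑-invariantʳ = ∑G-invariantʳ
    }
    where open ∑ℤ

  sumℤ-dihElems : ∀ (F : G → ℤ) → sumℤ (map F (dihElems m)) ≡ ∑ℤ.∑G F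
  sumℤ-dihElems F = trans (sumℤ-pairs (allFin m)) (trans (cong sumℤ (map-tabulate id H)) (sumℤ-tabulate H))
    where
    H : Fin m → ℤ
    H i = F (rot i) ℤ.+ F (ref i)
    sumℤ-pairs : ∀ is → sumℤ (map F (concatMap (λ i → rot i ∷ ref i ∷ []) is)) ≡ sumℤ (map H is)
    sumℤ-pairs []       = refl
    sumℤ-pairs (i ∷ is) = trans (sym (ℤP.+-assoc (F (rot i)) (F (ref i)) _)) (cong (λ x → H i ℤ.+ x) (sumℤ-pairs is))
    sumℤ-tabulate : ∀ {k} (f : Fin k → ℤ) → sumℤ (tabulate f) ≡ ∑ℤ.sum f
    sumℤ-tabulate {zero}  f = refl
    sumℤ-tabulate {suc k} f = cong (λ x → f Fin.zero ℤ.+ x) (sumℤ-tabulate (λ i → f (Fin.suc i)))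

-- Cocycles on the dihedral group

module DihedralCocycle (n : ℕ) {ψ : Dihedral (suc (2 * n)) → Dihedral (suc (2 * n)) → Sign}
  (cocycle : IsNormalizedCocycle (dihMul (suc (2 * n))) (dihOne (suc (2 * n))) ψ) where

  open DihedralGroup (2 * n)
  open CocycleSums {_·_ = _·_} {e} {ψ} cocycle ·-identityˡ ·-identityʳ
  open Sums invariantSum
  open ≡-Reasoning

  -- m is odd, so c = 2 · ((n + 1) c) in ℤ/m.
  half : Fin m → Fin m
  half c = (toℕ c ℕ.* suc n) mod m

  rot-square : ∀ c → rot (half c) · rot (half c) ≡ rot c
  rot-square c = cong rot (trans (mod-cong (toℕ (half c) ℕ.+ toℕ (half c)) (toℕ c) (begin
    (toℕ (half c) ℕ.+ toℕ (half c)) % m              ≡⟨ cong₂ (λ x y → (x ℕ.+ y) % m) (toℕ-mod (toℕ c ℕ.* suc n)) (toℕ-mod (toℕ c ℕ.* suc n)) ⟩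
    (c[n+1] % m ℕ.+ c[n+1] % m) % m                  ≡⟨ %-absorbˡ c[n+1] (c[n+1] % m) ⟩
    (c[n+1] ℕ.+ c[n+1] % m) % m                      ≡⟨ %-absorbʳ c[n+1] c[n+1] ⟩
    (c[n+1] ℕ.+ c[n+1]) % m                          ≡⟨ cong (_% m) (double (toℕ c) n) ⟩
    (toℕ c ℕ.+ toℕ c ℕ.* m) % m                      ≡⟨ [m+kn]%n≡m%n (toℕ c) (toℕ c) m ⟩
    toℕ c % m                                        ∎)) (toℕ-mod-id c))
    where
    c[n+1] : ℕ
    c[n+1] = toℕ c ℕ.* suc n
    double : ∀ c n → c ℕ.* suc n ℕ.+ c ℕ.* suc n ≡ c ℕ.+ c ℕ.* suc (2 * n)
    double = solve-∀

  φ φ̃ : G → Sign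
  φ g = ∏±.sum (λ l → ψ g (rot l))
  φ̃ g = ∏±.sum (λ l → ψ g (ref l))

  χ : G → Sign
  χ g = ∏±.∑G (ψ g)

  ∏-const : ∀ s → ∏±.sum (λ (_ : Fin m) → s) ≡ s
  ∏-const s = begin
    ∏±.sum {m} (λ _ → s)                ≡⟨ ∏±.sum-replicate m {s} ⟩
    s ⊛ ((n ℕ.+ (n ℕ.+ 0)) ×ₛ s)        ≡⟨ cong (s ⊛_) (×-homo-+ s n (n ℕ.+ 0)) ⟩
    s ⊛ ((n ×ₛ s) ⊛ ((n ℕ.+ 0) ×ₛ s))   ≡⟨ cong (λ k → s ⊛ ((n ×ₛ s) ⊛ (k ×ₛ s))) (ℕP.+-identityʳ n) ⟩
    s ⊛ ((n ×ₛ s) ⊛ (n ×ₛ s))           ≡⟨ cong (s ⊛_) (s*s≡+ (n ×ₛ s)) ⟩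
    s ⊛ +                             ≡⟨ *-identityʳ s ⟩
    s                                 ∎
    where open Algebra.Properties.Monoid.Mult Data.Sign.Properties.*-monoid using (×-homo-+) renaming (_×_ to _×ₛ_)

  ∏-cocycle : ∀ g h → ψ g h ⊛ φ (g · h) ≡ ∏±.sum (λ l → ψ g (h · rot l)) ⊛ φ h
  ∏-cocycle g h = begin
    ψ g h ⊛ φ (g · h)                                            ≡⟨ cong (_⊛ φ (g · h)) (sym (∏-const (ψ g h))) ⟩
    ∏±.sum {m} (λ _ → ψ g h) ⊛ φ (g · h)                             ≡⟨ sym (∏±.∑-distrib-+ {m} (λ _ → ψ g h) (λ l → ψ (g · h) (rot l))) ⟩
    ∏±.sum (λ l → ψ g h ⊛ ψ (g · h) (rot l))                     ≡⟨ ∏±.sum-cong-≗ (λ l → proj₂ cocycle g h (rot l)) ⟩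
    ∏±.sum (λ l → ψ g (h · rot l) ⊛ ψ h (rot l))                 ≡⟨ ∏±.∑-distrib-+ (λ l → ψ g (h · rot l)) (λ l → ψ h (rot l)) ⟩
    ∏±.sum (λ l → ψ g (h · rot l)) ⊛ φ h                         ∎

  ψ-rotʳ : ∀ g c → ψ g (rot c) ≡ coboundary φ g (rot c)
  ψ-rotʳ g c = ⊛-moveʳ (ψ g (rot c)) (φ (g · rot c)) (φ g ⊛ φ (rot c))
    (trans (∏-cocycle g (rot c)) (cong (_⊛ φ (rot c)) (∏±.sum-+ₘˡ c (λ l → ψ g (rot l)))))

  ψ-refʳ : ∀ g c → ψ g (ref c) ≡ χ g ⊛ coboundary φ g (ref c)
  ψ-refʳ g c = begin
    ψ g (ref c)                               ≡⟨ ⊛-moveʳ (ψ g (ref c)) (φ h) (φ̃ g ⊛ φ (ref c)) ∏-cocycle-ref ⟩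
    φ̃ g ⊛ φ (ref c) ⊛ φ h                     ≡⟨ cong (λ s → s ⊛ φ (ref c) ⊛ φ h) φ̃≡χ⊛φ ⟩
    χ g ⊛ φ g ⊛ φ (ref c) ⊛ φ h               ≡⟨ cong (_⊛ φ h) (*-assoc (χ g) (φ g) (φ (ref c))) ⟩
    χ g ⊛ (φ g ⊛ φ (ref c)) ⊛ φ h             ≡⟨ *-assoc (χ g) (φ g ⊛ φ (ref c)) (φ h) ⟩
    χ g ⊛ coboundary φ g (ref c)              ∎
    where
    h = g · ref c
    ∏-cocycle-ref : ψ g (ref c) ⊛ φ h ≡ φ̃ g ⊛ φ (ref c)
    ∏-cocycle-ref = trans (∏-cocycle g (ref c)) (cong (_⊛ φ (ref c)) (∏±.sum--ₘˡ c (λ l → ψ g (ref l))))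
    φ̃≡χ⊛φ : φ̃ g ≡ χ g ⊛ φ g
    φ̃≡χ⊛φ = ⊛-moveʳ (φ̃ g) (φ g) (χ g)
      (trans (*-comm (φ̃ g) (φ g)) (sym (∏±.∑-distrib-+ (λ l → ψ g (rot l)) (λ l → ψ g (ref l)))))

  χ-hom : ∀ g h → χ (g · h) ≡ χ g ⊛ χ h
  χ-hom g h = begin
    χ (g · h)                                  ≡⟨ cong (_⊛ χ (g · h)) (sym ∏G-const) ⟩
    ∏±.∑G (λ _ → ψ g h) ⊛ χ (g · h)            ≡⟨ sym (∏±.∑G-distrib (λ _ → ψ g h) (ψ (g · h))) ⟩
    ∏±.∑G (λ k → ψ g h ⊛ ψ (g · h) k)          ≡⟨ ∏±.sum-cong-≗ (λ i → cong₂ _⊛_ (proj₂ cocycle g h (rot i)) (proj₂ cocycle g h (ref i))) ⟩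
    ∏±.∑G (λ k → ψ g (h · k) ⊛ ψ h k)          ≡⟨ ∏±.∑G-distrib (λ k → ψ g (h · k)) (ψ h) ⟩
    ∏±.∑G (λ k → ψ g (h · k)) ⊛ χ h            ≡⟨ cong (_⊛ χ h) (∏±.∑G-invariantˡ h (ψ g)) ⟩
    χ g ⊛ χ h                                  ∎
    where
    ∏G-const : ∏±.∑G (λ _ → ψ g h) ≡ +
    ∏G-const = trans (∏±.sum-cong-≗ {m} (λ _ → s*s≡+ (ψ g h))) (∏±.sum-replicate-zero m)

  χ-rot : ∀ c → χ (rot c) ≡ +
  χ-rot c = begin
    χ (rot c)                                  ≡⟨ cong χ (sym (rot-square c)) ⟩
    χ (rot (half c) · rot (half c))            ≡⟨ χ-hom (rot (half c)) (rot (half c)) ⟩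
    χ (rot (half c)) ⊛ χ (rot (half c))        ≡⟨ s*s≡+ (χ (rot (half c))) ⟩
    +                                          ∎

  χ-ref : ∀ c → χ (ref c) ≡ χ (ref 0ₘ)
  χ-ref c = begin
    χ (ref c)                      ≡⟨ cong χ (sym (rot·ref0 c)) ⟩
    χ (rot c · ref 0ₘ)             ≡⟨ χ-hom (rot c) (ref 0ₘ) ⟩
    χ (rot c) ⊛ χ (ref 0ₘ)         ≡⟨ cong (_⊛ χ (ref 0ₘ)) (χ-rot c) ⟩
    χ (ref 0ₘ)                     ∎

  φ-identity : φ e ≡ +
  φ-identity = trans (∏±.sum-cong-≗ {m} (λ l → ψ-identityˡ (rot l))) (∏±.sum-replicate-zero m)

  -- When χ is trivial, ψ is the coboundary of φ.
  χ-ref≡- : ¬ IsCoboundary _·_ e ψ → ∀ c → χ (ref c) ≡ -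
  χ-ref≡- ¬coboundary c with χ (ref 0ₘ) in χref0
  ... | - = trans (χ-ref c) χref0
  ... | + = contradiction (φ , φ-identity , ψ≡∂φ) ¬coboundary
    where
    χ≡+ : ∀ g → χ g ≡ +
    χ≡+ (c , false) = χ-rot c
    χ≡+ (c , true)  = trans (χ-ref c) χref0
    ψ≡∂φ : ∀ g h → ψ g h ≡ coboundary φ g h
    ψ≡∂φ g (c , false) = ψ-rotʳ g c
    ψ≡∂φ g (c , true)  = trans (ψ-refʳ g c) (cong (_⊛ coboundary φ g (ref c)) (χ≡+ g))

  ψ-rotˡ : ∀ a h → ψ (rot a) h ≡ coboundary φ (rot a) h
  ψ-rotˡ a (c , false) = ψ-rotʳ (rot a) c
  ψ-rotˡ a (c , true)  = trans (ψ-refʳ (rot a) c) (cong (_⊛ coboundary φ (rot a) (ref c)) (χ-rot a))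

  open Coboundary φ

  module Normality (¬coboundary : ¬ IsCoboundary _·_ e ψ) where

    ψ-ref-ref : ∀ c → ψ (ref c) (ref c) ≡ -
    ψ-ref-ref c = begin
      ψ (ref c) (ref c)                                        ≡⟨ ψ-refʳ (ref c) c ⟩
      χ (ref c) ⊛ (φ (ref c) ⊛ φ (ref c) ⊛ φ (ref c · ref c))  ≡⟨ cong₂ (λ s t → χ (ref c) ⊛ (s ⊛ φ t)) (s*s≡+ (φ (ref c))) (ref-involution c) ⟩
      χ (ref c) ⊛ φ e                                          ≡⟨ cong₂ _⊛_ (χ-ref≡- ¬coboundary c) φ-identity ⟩
      -                                                        ∎

    open InvariantSum invariantSum using (∑-symmetricʳ)

    correlation-symmetric : ∀ k l → correlation k l ≡ correlation l k
    correlation-symmetric k l = cong signToℤ (*-comm (φ k) (φ l))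

    left≡rightCorrelation : ∀ a → leftCorrelation (rot a) ≡ rightCorrelation (rot a)
    left≡rightCorrelation a = begin
      sum (λ i → w (rot i) (rot (a +ₘ i)) ℤ.+ w (ref i) (ref (a +ₘ i)))               ≡⟨ ∑-distrib-+ (λ i → w (rot i) (rot (a +ₘ i))) (λ i → w (ref i) (ref (a +ₘ i))) ⟩
      sum (λ i → w (rot i) (rot (a +ₘ i))) ℤ.+ sum (λ i → w (ref i) (ref (a +ₘ i)))   ≡⟨ cong₂ ℤ._+_ rotations reflections ⟩
      sum (λ i → w (rot i) (rot (i +ₘ a))) ℤ.+ sum (λ i → w (ref i) (ref (i -ₘ a)))   ≡⟨ sym (∑-distrib-+ (λ i → w (rot i) (rot (i +ₘ a))) (λ i → w (ref i) (ref (i -ₘ a)))) ⟩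
      sum (λ i → w (rot i) (rot (i +ₘ a)) ℤ.+ w (ref i) (ref (i -ₘ a)))               ∎
      where
      open ∑ℤ
      w = correlation
      rotations : sum (λ i → w (rot i) (rot (a +ₘ i))) ≡ sum (λ i → w (rot i) (rot (i +ₘ a)))
      rotations = sum-cong-≗ (λ i → cong (λ j → w (rot i) (rot j)) (+ₘ-comm a i))
      reflections : sum (λ i → w (ref i) (ref (a +ₘ i))) ≡ sum (λ i → w (ref i) (ref (i -ₘ a)))
      reflections = begin
        sum (λ i → w (ref i) (ref (a +ₘ i)))                 ≡⟨ sum-cong-≗ (λ i → trans (correlation-symmetric (ref i) (ref (a +ₘ i)))
                                                                    (cong (λ j → w (ref (a +ₘ i)) (ref j)) (sym (+ₘ-ₘ-cancelʳ a i)))) ⟩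
        sum (λ i → w (ref (a +ₘ i)) (ref ((a +ₘ i) -ₘ a)))   ≡⟨ sum-+ₘˡ a (λ i → w (ref i) (ref (i -ₘ a))) ⟩
        sum (λ i → w (ref i) (ref (i -ₘ a)))                 ∎

    rotationCase : ∀ {g h} a b → rot a · g ≡ h → g · rot b ≡ h →
                   rightCorrelation (rot a) ≡ rightCorrelation (rot b) →
                   rowProduct g h ≡ colProduct g h
    rotationCase {g} {h} a b xg≡h gy≡h right≡ = begin
      rowProduct g h                                       ≡⟨ rowProduct-coboundary xg≡h (ψ-rotˡ a) ⟩
      signToℤ (φ g ⊛ φ h) ℤ.* leftCorrelation (rot a)    ≡⟨ cong (signToℤ (φ g ⊛ φ h) ℤ.*_) (trans (left≡rightCorrelation a) right≡) ⟩
      signToℤ (φ g ⊛ φ h) ℤ.* rightCorrelation (rot b)   ≡⟨ sym (colProduct-coboundary gy≡h (λ k → ψ-rotʳ k b)) ⟩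
      colProduct g h                                       ∎

    reflectionCase : ∀ {g h} a b → ref a · g ≡ h → g · ref b ≡ h →
                     rowProduct g h ≡ colProduct g h
    reflectionCase {g} {h} a b xg≡h gy≡h = begin
      rowProduct g h                              ≡⟨ rowProduct-translate xg≡h ⟩
      signToℤ (ψ (ref a) g) ℤ.* rowSum (ref a)    ≡⟨ cong (signToℤ (ψ (ref a) g) ℤ.*_) (rowSum-involution (ref-involution a) (ψ-ref-ref a)) ⟩
      signToℤ (ψ (ref a) g) ℤ.* 0ℤ                             ≡⟨ ℤP.*-zeroʳ (signToℤ (ψ (ref a) g)) ⟩
      0ℤ                                                       ≡⟨ sym (ℤP.*-zeroʳ (signToℤ (ψ g (ref b)))) ⟩
      signToℤ (ψ g (ref b)) ℤ.* 0ℤ                             ≡⟨ cong (signToℤ (ψ g (ref b)) ℤ.*_) (sym (colSum-involution (ref-involution b) (ψ-ref-ref b))) ⟩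
      signToℤ (ψ g (ref b)) ℤ.* colSum (ref b)    ≡⟨ sym (colProduct-translate gy≡h) ⟩
      colProduct g h                              ∎

    rowProduct≡colProduct : ∀ g h → rowProduct g h ≡ colProduct g h
    rowProduct≡colProduct (i , false) (j , false) =
      rotationCase (j -ₘ i) (j -ₘ i) (cong rot (-ₘ+ₘ-cancel i j)) (cong rot (+ₘ-ₘ-cancelˡ i j)) refl
    rowProduct≡colProduct (i , true) (j , true) =
      rotationCase (j -ₘ i) (i -ₘ j) (cong ref (-ₘ+ₘ-cancel i j)) (cong ref (-ₘ-ₘ-cancel i j))
        (∑-symmetricʳ (correlation) correlation-symmetric (rot (j -ₘ i)) (rot (i -ₘ j))
                      (·rot-cancel (j -ₘ i) (i -ₘ j) (-ₘ-opposite i j)))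
    rowProduct≡colProduct (i , false) (j , true) =
      reflectionCase (j +ₘ i) (j -ₘ i) (cong ref (+ₘ-ₘ-cancel i j)) (cong ref (+ₘ-ₘ-cancelˡ i j))
    rowProduct≡colProduct (i , true) (j , false) =
      reflectionCase (j +ₘ i) (i -ₘ j) (cong rot (+ₘ-ₘ-cancel i j)) (cong rot (-ₘ-ₘ-cancel i j))

    normal : IsNormalMatrix (dihElems m) ψ
    normal g h = begin
      sumℤ (map (λ k → signToℤ (ψ g k) ℤ.* signToℤ (ψ h k)) (dihElems m))  ≡⟨ sumℤ-dihElems (λ k → signToℤ (ψ g k) ℤ.* signToℤ (ψ h k)) ⟩
      rowProduct g h                                          ≡⟨ rowProduct≡colProduct g h ⟩
      colProduct g h                                          ≡⟨ sym (sumℤ-dihElems (λ k → signToℤ (ψ k g) ℤ.* signToℤ (ψ k h))) ⟩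
      sumℤ (map (λ k → signToℤ (ψ k g) ℤ.* signToℤ (ψ k h)) (dihElems m))  ∎

proposition6 : (n : ℕ) →
    -- m = 2n+1 is an arbitrary odd number
    ( (A : Set) (_∙_ : A → A → A) (e : A) (inv : A → A) →
      IsAbelianGroup _≡_ _∙_ e inv →
      (f : Fin (2 * suc (2 * n)) ⤖ A) →
      (ψ : A → A → Sign) → IsNormalizedCocycle _∙_ e ψ →
      IsNormalMatrix (map (Bijection.to f) (allFin (2 * suc (2 * n)))) ψ )
    ×
    ( (ψ : Dihedral (suc (2 * n)) → Dihedral (suc (2 * n)) → Sign) →
      IsNormalizedCocycle (dihMul (suc (2 * n))) (dihOne (suc (2 * n))) ψ →
      ¬ IsCoboundary (dihMul (suc (2 * n))) (dihOne (suc (2 * n))) ψ →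
      IsNormalMatrix (dihElems (suc (2 * n))) ψ )
proposition6 n =
  (λ A _∙_ e inv isAbelianGroup f ψ cocycle →
    EnumeratedAbelianGroup.normal isAbelianGroup f {ψ} cocycle (4∤2[2n+1] n)) ,
  (λ ψ cocycle ¬coboundary → DihedralCocycle.Normality.normal n {ψ} cocycle ¬coboundary)
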